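{- Let $k\ge 3$ and let $\mathscr{T}$ be a chemical $k$-uniform hypertree on $n$ vertices, with $m=\frac{n-1}{k-1}$ edges, and write $m-1=3a+i$ with integers $a\ge 0$, $i\in\{0,1,2\}$. Then $h(\mathscr{T})\leq h(\mathscr{T}^*)$ for any $\mathscr{T}^*$ in the class $\mathscr{T}^*$ defined below, with equality if and only if $\mathscr{T}\in \mathscr{T}^*$.
   Context: All hypergraphs are simple and connected. The degree of a vertex is the number of edges containing it. The $k$-th power of an ordinary graph $G$ is obtained by adding $k-2$ new vertices (distinct for each edge) to every edge of $G$. A $k$-uniform hypertree is the $k$-th power of an ordinary tree; a chemical hypertree is a hypertree with maximum degree at most $4$. For distinct vertices $v_i,v_j$ let $a_{ij}$ be the number of edges containing both (with $a_{ii}=0$); the Laplacian degree of $v_i$ is $\delta_i=\sum_j a_{ij}$, and $h(\mathcal{H})=\sum_{i=1}^n\delta_i\log_2\delta_i$. The class $\mathscr{T}^*$ consists of the $k$-uniform hypertrees on $n$ vertices (with $m$ edges, $m-1=3a+i$) whose Laplacian degree sequence consists of $a$ entries equal to $4k-4$, one entry equal to $(i+1)(k-1)$, and $n-a-1$ entries equal to $k-1$ (so all members of $\mathscr{T}^*$ have the same value of $h$). -}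

module Defs where

open import Data.Nat using (ℕ; zero; suc; _+_; _*_; _∸_; _^_; _≤_)
open import Data.Bool using (Bool; true; false; _∧_; if_then_else_)
open import Data.Fin using (Fin; zero; suc; splitAt; remQuot; _≟_)
open import Data.Fin.Subset using (Subset)
open import Data.Vec using (lookup; tabulate)
open import Data.Sum using (_⊎_; inj₁; inj₂)
open import Data.Product using (_×_; _,_; proj₁; proj₂)
open import Data.List using (List; _∷_; []; _++_; replicate)
import Data.List as L
open import Relation.Nullary using (¬_)
open import Relation.Nullary.Decidable using (⌊_⌋)
open import Relation.Binary.PropositionalEquality using (_≡_)

∑ : ∀ {m} → (Fin m → ℕ) → ℕ
∑ {zero}  f = 0
∑ {suc m} f = f zero + ∑ (λ j → f (suc j))

∏ : ∀ {m} → (Fin m → ℕ) → ℕ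
∏ {zero}  f = 1
∏ {suc m} f = f zero * ∏ (λ j → f (suc j))

record Graph (p m : ℕ) : Set where
  field
    ends     : Fin m → Fin p × Fin p
    loopless : ∀ e → ¬ (proj₁ (ends e) ≡ proj₂ (ends e))
    simple   : ∀ e f → (ends e ≡ ends f ⊎ ends e ≡ (proj₂ (ends f) , proj₁ (ends f))) → e ≡ f

open Graph public

Adj : ∀ {p m} → Graph p m → Fin p → Fin p → Set
Adj {m = m} G u v = Data.Product.Σ (Fin m) λ e → ends G e ≡ (u , v) ⊎ ends G e ≡ (v , u)

data Reach {p m} (G : Graph p m) : Fin p → Fin p → Set where
  here : ∀ {u} → Reach G u u
  step : ∀ {u v w} → Adj G u v → Reach G v w → Reach G u w

Connected : ∀ {p m} → Graph p m → Set
Connected {p} G = (u v : Fin p) → Reach G u v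

-- An (ordinary) tree with m edges: a connected simple graph on m+1 vertices
-- (equivalently, connected and acyclic).
record Tree (m : ℕ) : Set where
  field
    graph     : Graph (suc m) m
    connected : Connected graph

open Tree public

record Hypergraph (n : ℕ) : Set where
  field
    nedges : ℕ
    edge   : Fin nedges → Subset n

open Hypergraph public

_∈ᵇ_ : ∀ {n} → Fin n → Subset n → Bool
v ∈ᵇ S = lookup S v

b2n : Bool → ℕ
b2n true  = 1
b2n false = 0

degree : ∀ {n} → Hypergraph n → Fin n → ℕ
degree H v = ∑ λ e → b2n (v ∈ᵇ edge H e)

adjCount : ∀ {n} → Hypergraph n → Fin n → Fin n → ℕ
adjCount H i j =
  if ⌊ i ≟ j ⌋ then 0 else ∑ λ e → b2n (i ∈ᵇ edge H e ∧ j ∈ᵇ edge H e)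

lapDeg : ∀ {n} → Hypergraph n → Fin n → ℕ
lapDeg {n} H i = ∑ λ j → adjCount H i j

-- 2^{h(H)} = ∏_i δ_i^{δ_i}, where h(H) = Σ_i δ_i log₂ δ_i
-- (with the convention 0 log 0 = 0, matching 0^0 = 1).
expH : ∀ {n} → Hypergraph n → ℕ
expH H = ∏ λ i → lapDeg H i ^ lapDeg H i

lapDegSeq : ∀ {n} → Hypergraph n → List ℕ
lapDegSeq {n} H = L.tabulate (lapDeg H)

Chemical : ∀ {n} → Hypergraph n → Set
Chemical {n} H = (v : Fin n) → degree H v ≤ 4

-- Vertex set: Fin (suc m + m * (k ∸ 2)); the first suc m vertices are the
-- tree vertices, and vertex (suc m) ↑ʳ w with remQuot w = (e , j) is the
-- j-th new vertex added to edge e.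

powVerts : ℕ → ℕ → ℕ
powVerts k m = suc m + m * (k ∸ 2)

power : (k : ℕ) → ∀ {m} → Tree m → Hypergraph (powVerts k m)
power k {m} T = record
  { nedges = m
  ; edge   = λ e → tabulate λ v → mem e (splitAt (suc m) v)
  }
  where
  mem : Fin m → Fin (suc m) ⊎ Fin (m * (k ∸ 2)) → Bool
  mem e (inj₁ u) = ⌊ u ≟ proj₁ (ends (graph T) e) ⌋ Data.Bool.∨ ⌊ u ≟ proj₂ (ends (graph T) e) ⌋
  mem e (inj₂ w) = ⌊ proj₁ (remQuot {m} (k ∸ 2) w) ≟ e ⌋

-- The class 𝒯* (for parameters k, a, i and n vertices): Laplacian degree
-- sequence is a permutation of  a × (4k-4), one (i+1)(k-1), (n-a-1) × (k-1).

starSeq : (k n a i : ℕ) → List ℕ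
starSeq k n a i =
  replicate a (4 * k ∸ 4) ++ ((suc i * (k ∸ 1)) ∷ []) ++ replicate (n ∸ a ∸ 1) (k ∸ 1)

{-# OPTIONS --safe #-}
module Submission where

-- In a k-uniform hypergraph every Laplacian degree is δ = (k − 1)·deg, so for the power of a
-- tree 2^h = ∏ (c·d)^(c·d) over the degrees d ∈ {1,…,4} (c = k − 1), while the number of
-- vertices and the degree sum are fixed by m. The weight d ↦ (c·d)^(c·d) is strictly
-- log-convex, so replacing two degrees 2,2 by 1,3, or 3,3 by 2,4, or 2,3 by 1,4 keeps the
-- number of entries and their sum but strictly increases the product. These moves
-- terminate in a degree list with at most one entry in {2,3}, and such a list is
-- determined by its length and sum: it is the degree list of 𝒯*.

open import Defs
open import Data.Nat using (ℕ; zero; suc; _+_; _*_; _∸_; _^_; _≤_; _<_; z≤n; s≤s; NonZero; >-nonZero; _<?_)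
open import Data.Nat.Properties hiding (_≟_)
open import Data.Nat.DivMod using (_%_; [m+kn]%n≡m%n; m<n⇒m%n≡m)
open import Data.Nat.Induction using (<-wellFounded)
open import Data.Nat.ListAction using (sum; product)
open import Data.Nat.ListAction.Properties using (sum-++; sum-↭; product-↭)
open import Data.Nat.Tactic.RingSolver using (solve-∀)
open import Algebra.Properties.CommutativeSemigroup +-commutativeSemigroup using (x∙yz≈y∙xz)
open import Algebra.Properties.CommutativeSemigroup *-commutativeSemigroup using (interchange)
import Algebra.Properties.CommutativeMonoid.Sum +-0-commutativeMonoid as VecSum
import Algebra.Properties.Semiring.Sum +-*-semiring as VecSemiringSum
open import Data.Bool using (Bool; true; false; _∧_; _∨_; if_then_else_)
open import Data.Bool.Properties using (∨-zeroʳ)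
open import Data.Fin using (Fin; zero; suc; splitAt; _≟_; remQuot; combine; _↑ˡ_; _↑ʳ_)
open import Data.Fin.Properties using (splitAt-↑ˡ; splitAt-↑ʳ; remQuot-combine)
open import Data.Product using (_×_; _,_; proj₁; proj₂; ∃-syntax)
open import Data.Sum using (_⊎_; inj₁; inj₂)
open import Data.Empty using (⊥-elim)
open import Data.Vec using (Vec; _∷_; tabulate; lookup)
open import Data.Vec.Properties using (lookup∘tabulate)
open import Data.List using (List; []; _∷_; _++_; replicate; map; length)
import Data.List as List
open import Data.List.Properties using (length-++; length-replicate; length-tabulate; ++-identityʳ; map-++; map-replicate; map-tabulate; tabulate-cong; map-∘)
open import Data.List.Relation.Unary.All using (All; []; _∷_)
open import Data.List.Relation.Unary.All.Properties using (tabulate⁺)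
open import Data.List.Relation.Binary.Permutation.Propositional using (_↭_; prep; ↭-refl; ↭-reflexive; ↭-sym; ↭-trans)
open import Data.List.Relation.Binary.Permutation.Propositional.Properties using (shift; ++⁺ˡ; map⁺; ↭-length)
open import Function using (_∘_; flip)
open import Function.Bundles using (_⇔_; mk⇔)
open import Induction.WellFounded using (Acc; acc)
open import Relation.Nullary using (Dec; yes; no; ¬_)
open import Relation.Nullary.Decidable using (⌊_⌋; from-yes; isYes≗does; dec-true)
open import Relation.Binary.PropositionalEquality

quotRem-unique : ∀ {n} .{{_ : NonZero n}} {i j p q : ℕ} → i < n → j < n
               → i + p * n ≡ j + q * n → i ≡ j × p ≡ q
quotRem-unique {n} {i} {j} {p} {q} i<n j<n eq =
  i≡j , *-cancelʳ-≡ p q n (+-cancelˡ-≡ i _ _ (trans eq (cong (_+ q * n) (sym i≡j))))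
  where
  open ≡-Reasoning
  i≡j : i ≡ j
  i≡j = begin
    i                ≡⟨ m<n⇒m%n≡m i<n ⟨
    i % n            ≡⟨ [m+kn]%n≡m%n i p n ⟨
    (i + p * n) % n  ≡⟨ cong (_% n) eq ⟩
    (j + q * n) % n  ≡⟨ [m+kn]%n≡m%n j q n ⟩
    j % n            ≡⟨ m<n⇒m%n≡m j<n ⟩
    j                ∎

^-distribʳ-* : ∀ m n o → (m * n) ^ o ≡ m ^ o * n ^ o
^-distribʳ-* m n zero    = refl
^-distribʳ-* m n (suc o) = trans (cong (m * n *_) (^-distribʳ-* m n o)) (interchange m n (m ^ o) (n ^ o))

⌊⌋-true : ∀ {A : Set} (a? : Dec A) → A → ⌊ a? ⌋ ≡ true
⌊⌋-true a? a = trans (isYes≗does a?) (dec-true a? a)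

b2n-∧ : ∀ x y → b2n (x ∧ y) ≡ b2n x * b2n y
b2n-∧ true  y = sym (+-identityʳ (b2n y))
b2n-∧ false y = refl

b2n-*-∸ : ∀ x k → b2n x * (k ∸ b2n x) ≡ b2n x * (k ∸ 1)
b2n-*-∸ true  k = refl
b2n-*-∸ false k = refl

∑≡sum : ∀ {n} (f : Fin n → ℕ) → ∑ f ≡ VecSum.sum f
∑≡sum {zero}  f = refl
∑≡sum {suc n} f = cong (f zero +_) (∑≡sum (f ∘ suc))

∑-cong : ∀ {n} {f g : Fin n → ℕ} → (∀ i → f i ≡ g i) → ∑ f ≡ ∑ g
∑-cong {f = f} {g} f≗g = trans (∑≡sum f) (trans (VecSum.sum-cong-≗ f≗g) (sym (∑≡sum g)))

∑-distrib-+ : ∀ {n} (f g : Fin n → ℕ) → ∑ (λ i → f i + g i) ≡ ∑ f + ∑ g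
∑-distrib-+ f g = trans (∑≡sum (λ i → f i + g i))
  (trans (VecSum.∑-distrib-+ f g) (sym (cong₂ _+_ (∑≡sum f) (∑≡sum g))))

*-distribˡ-∑ : ∀ {n} c (f : Fin n → ℕ) → c * ∑ f ≡ ∑ (λ i → c * f i)
*-distribˡ-∑ c f = trans (cong (c *_) (∑≡sum f))
  (trans (VecSemiringSum.*-distribˡ-sum c f) (sym (∑≡sum (λ i → c * f i))))

∑-comm : ∀ {m n} (f : Fin m → Fin n → ℕ) → ∑ (λ i → ∑ (f i)) ≡ ∑ (λ j → ∑ (λ i → f i j))
∑-comm f = trans (∑∑≡sumsum f) (trans (VecSum.∑-comm f) (sym (∑∑≡sumsum (flip f))))
  where
  ∑∑≡sumsum : ∀ {m n} (g : Fin m → Fin n → ℕ) → ∑ (λ i → ∑ (g i)) ≡ VecSum.sum (λ i → VecSum.sum (g i))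
  ∑∑≡sumsum g = trans (∑≡sum (λ i → ∑ (g i))) (VecSum.sum-cong-≗ (λ i → ∑≡sum (g i)))

∑-const : ∀ n c → ∑ {n} (λ _ → c) ≡ n * c
∑-const zero    c = refl
∑-const (suc n) c = cong (c +_) (∑-const n c)

∑-↑ : ∀ p {q} (f : Fin (p + q) → ℕ) → ∑ f ≡ ∑ (λ i → f (i ↑ˡ q)) + ∑ (λ j → f (p ↑ʳ j))
∑-↑ zero    f = refl
∑-↑ (suc p) f = trans (cong (f zero +_) (∑-↑ p (f ∘ suc))) (sym (+-assoc (f zero) _ _))

∑-combine : ∀ m n (f : Fin (m * n) → ℕ) → ∑ f ≡ ∑ {m} (λ i → ∑ {n} (λ j → f (combine i j)))
∑-combine zero    n f = refl
∑-combine (suc m) n f =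
  trans (∑-↑ n f) (cong (∑ (λ j → f (j ↑ˡ (m * n))) +_) (∑-combine m n (f ∘ (n ↑ʳ_))))

term≤∑ : ∀ {n} (f : Fin n → ℕ) i → f i ≤ ∑ f
term≤∑ f zero    = m≤m+n (f zero) _
term≤∑ f (suc i) = ≤-trans (term≤∑ (f ∘ suc) i) (m≤n+m _ (f zero))

≟-suc : ∀ {n} (i j : Fin n) → ⌊ suc i ≟ suc j ⌋ ≡ ⌊ i ≟ j ⌋
≟-suc i j with i ≟ j
... | yes _ = refl
... | no  _ = refl

∑-indicator : ∀ {n} (x : Fin n) → ∑ (λ i → b2n ⌊ i ≟ x ⌋) ≡ 1
∑-indicator {suc n} zero    = cong suc (trans (∑-const n 0) (*-zeroʳ n))
∑-indicator {suc n} (suc x) = trans (∑-cong (λ i → cong b2n (≟-suc i x))) (∑-indicator x)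

∑-punctured : ∀ {n} (f : Fin n → ℕ) v → f v + ∑ (λ j → if ⌊ v ≟ j ⌋ then 0 else f j) ≡ ∑ f
∑-punctured f zero    = refl
∑-punctured f (suc v) = begin
  f (suc v) + (f zero + ∑ (λ j → if ⌊ suc v ≟ suc j ⌋ then 0 else f (suc j)))
    ≡⟨ x∙yz≈y∙xz (f (suc v)) (f zero) _ ⟩
  f zero + (f (suc v) + ∑ (λ j → if ⌊ suc v ≟ suc j ⌋ then 0 else f (suc j)))
    ≡⟨ cong (λ s → f zero + (f (suc v) + s)) (∑-cong (λ j → cong (λ b → if b then 0 else f (suc j)) (≟-suc v j))) ⟩
  f zero + (f (suc v) + ∑ (λ j → if ⌊ v ≟ j ⌋ then 0 else f (suc j)))
    ≡⟨ cong (f zero +_) (∑-punctured (f ∘ suc) v) ⟩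
  f zero + ∑ (f ∘ suc)
    ∎
  where open ≡-Reasoning

∑-tabulate : ∀ {n} (f : Fin n → ℕ) → ∑ f ≡ sum (List.tabulate f)
∑-tabulate {zero}  f = refl
∑-tabulate {suc n} f = cong (f zero +_) (∑-tabulate (f ∘ suc))

∏-tabulate : ∀ {n} (f : Fin n → ℕ) → ∏ f ≡ product (List.tabulate f)
∏-tabulate {zero}  f = refl
∏-tabulate {suc n} f = cong (f zero *_) (∏-tabulate (f ∘ suc))

-- Degree lists maximising a log-convex weight

sum-replicate : ∀ n x → sum (replicate n x) ≡ n * x
sum-replicate zero    x = refl
sum-replicate (suc n) x = cong (x +_) (sum-replicate n x)

star : ℕ → ℕ → ℕ → List ℕ
star p x q = replicate p 4 ++ x ∷ replicate q 1

fromCounts : ℕ → ℕ → ℕ → ℕ → List ℕ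
fromCounts n₁ n₂ n₃ n₄ = replicate n₄ 4 ++ replicate n₃ 3 ++ replicate n₂ 2 ++ replicate n₁ 1

record SameLengthAndSum (xs ys : List ℕ) : Set where
  constructor _,_
  field
    length≡ : length xs ≡ length ys
    sum≡    : sum xs ≡ sum ys

↭-sameLengthAndSum : ∀ {xs ys zs} → xs ↭ ys → SameLengthAndSum xs zs → SameLengthAndSum ys zs
↭-sameLengthAndSum xs↭ys (len , sm) = trans (sym (↭-length xs↭ys)) len , trans (sym (sum-↭ xs↭ys)) sm

excess-unique : ∀ {xs ys d e} → SameLengthAndSum xs ys
              → sum xs ≡ length xs + d → sum ys ≡ length ys + e → d ≡ e
excess-unique {xs} {ys} (len , sm) sxs sys =
  +-cancelˡ-≡ (length ys) _ _ (trans (cong (_+ _) (sym len)) (trans (sym sxs) (trans sm sys)))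

length-star : ∀ p x q → length (star p x q) ≡ p + suc q
length-star p x q = begin
  length (star p x q)                                    ≡⟨ length-++ (replicate p 4) ⟩
  length (replicate p 4) + suc (length (replicate q 1))  ≡⟨ cong₂ (λ s t → s + suc t) (length-replicate p) (length-replicate q) ⟩
  p + suc q                                              ∎
  where open ≡-Reasoning

sum-star : ∀ p j q → sum (star p (suc j) q) ≡ length (star p (suc j) q) + (j + p * 3)
sum-star p j q = begin
  sum (star p (suc j) q)                               ≡⟨ sum-++ (replicate p 4) _ ⟩
  sum (replicate p 4) + (suc j + sum (replicate q 1))  ≡⟨ cong₂ (λ s t → s + (suc j + t)) (sum-replicate p 4) (sum-replicate q 1) ⟩
  p * 4 + (suc j + q * 1)                              ≡⟨ regroup p j q ⟩
  (p + suc q) + (j + p * 3)                            ≡⟨ cong (_+ (j + p * 3)) (length-star p (suc j) q) ⟨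
  length (star p (suc j) q) + (j + p * 3)              ∎
  where
  open ≡-Reasoning
  regroup : ∀ p j q → p * 4 + (suc j + q * 1) ≡ (p + suc q) + (j + p * 3)
  regroup = solve-∀

length-fours : ∀ n → length (fromCounts 0 0 0 n) ≡ n
length-fours n = trans (cong length (++-identityʳ (replicate n 4))) (length-replicate n)

sum-fours : ∀ n → sum (fromCounts 0 0 0 n) ≡ length (fromCounts 0 0 0 n) + (0 + n * 3)
sum-fours n = begin
  sum (fromCounts 0 0 0 n)                   ≡⟨ cong sum (++-identityʳ (replicate n 4)) ⟩
  sum (replicate n 4)                        ≡⟨ sum-replicate n 4 ⟩
  n * 4                                      ≡⟨ regroup n ⟩
  n + n * 3                                  ≡⟨ cong (_+ n * 3) (length-fours n) ⟨
  length (fromCounts 0 0 0 n) + (0 + n * 3)  ∎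
  where
  open ≡-Reasoning
  regroup : ∀ n → n * 4 ≡ n + n * 3
  regroup = solve-∀

sameLengthAndSum-star : ∀ {ds p j q} → length ds ≡ length (star p (suc j) q) → sum ds ≡ length ds + (j + p * 3)
                      → SameLengthAndSum ds (star p (suc j) q)
sameLengthAndSum-star {p = p} {j} {q} len sm =
  len , trans sm (trans (cong (_+ (j + p * 3)) len) (sym (sum-star p j q)))

star-injective : ∀ {p q a r j i} → j < 3 → i < 3
               → SameLengthAndSum (star p (suc j) q) (star a (suc i) r) → star p (suc j) q ≡ star a (suc i) r
star-injective {p} {q} {a} {r} {j} {i} j<3 i<3 same@(len , _)
  with quotRem-unique {p = p} {q = a} j<3 i<3 (excess-unique same (sum-star p j q) (sum-star a i r))
... | refl , refl
  with suc-injective (+-cancelˡ-≡ p _ _ (trans (sym (length-star p (suc j) q)) (trans len (length-star p (suc j) r))))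
... | refl = refl

¬sameLengthAndSum-fours-star : ∀ {n a i r} → i < 3 → ¬ SameLengthAndSum (fromCounts 0 0 0 n) (star a (suc i) r)
¬sameLengthAndSum-fours-star {n} {a} {i} {r} i<3 same@(len , _)
  with quotRem-unique {p = n} {q = a} (s≤s z≤n) i<3 (excess-unique same (sum-fours n) (sum-star a i r))
... | refl , refl = m≢1+m+n n (begin
  n                                ≡⟨ length-fours n ⟨
  length (fromCounts 0 0 0 n)      ≡⟨ len ⟩
  length (star n (suc i) r)        ≡⟨ length-star n (suc i) r ⟩
  n + suc r                        ≡⟨ +-suc n r ⟩
  suc (n + r)                      ∎)
  where open ≡-Reasoning

∷-shift : ∀ (x : ℕ) xs ys → x ∷ xs ++ ys ↭ xs ++ x ∷ ys
∷-shift x xs ys = ↭-sym (shift x xs ys)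

1∷fromCounts : ∀ n₁ n₂ n₃ n₄ → 1 ∷ fromCounts n₁ n₂ n₃ n₄ ↭ fromCounts (suc n₁) n₂ n₃ n₄
1∷fromCounts n₁ n₂ n₃ n₄ =
  ↭-trans (∷-shift 1 (replicate n₄ 4) _) (++⁺ˡ (replicate n₄ 4)
  (↭-trans (∷-shift 1 (replicate n₃ 3) _) (++⁺ˡ (replicate n₃ 3) (∷-shift 1 (replicate n₂ 2) _))))

2∷fromCounts : ∀ n₁ n₂ n₃ n₄ → 2 ∷ fromCounts n₁ n₂ n₃ n₄ ↭ fromCounts n₁ (suc n₂) n₃ n₄
2∷fromCounts n₁ n₂ n₃ n₄ =
  ↭-trans (∷-shift 2 (replicate n₄ 4) _) (++⁺ˡ (replicate n₄ 4) (∷-shift 2 (replicate n₃ 3) _))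

3∷fromCounts : ∀ n₁ n₂ n₃ n₄ → 3 ∷ fromCounts n₁ n₂ n₃ n₄ ↭ fromCounts n₁ n₂ (suc n₃) n₄
3∷fromCounts n₁ n₂ n₃ n₄ = ∷-shift 3 (replicate n₄ 4) _

InRange : ℕ → Set
InRange d = 1 ≤ d × d ≤ 4

counts : ∀ {ds} → All InRange ds → ∃[ n₁ ] ∃[ n₂ ] ∃[ n₃ ] ∃[ n₄ ] ds ↭ fromCounts n₁ n₂ n₃ n₄
counts [] = 0 , 0 , 0 , 0 , ↭-refl
counts (d∈ ∷ ds∈) with counts ds∈
... | n₁ , n₂ , n₃ , n₄ , ds↭ with d∈
...   | s≤s z≤n , s≤s z≤n                   = suc n₁ , n₂ , n₃ , n₄ , ↭-trans (prep 1 ds↭) (1∷fromCounts n₁ n₂ n₃ n₄)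
...   | s≤s z≤n , s≤s (s≤s z≤n)             = n₁ , suc n₂ , n₃ , n₄ , ↭-trans (prep 2 ds↭) (2∷fromCounts n₁ n₂ n₃ n₄)
...   | s≤s z≤n , s≤s (s≤s (s≤s z≤n))       = n₁ , n₂ , suc n₃ , n₄ , ↭-trans (prep 3 ds↭) (3∷fromCounts n₁ n₂ n₃ n₄)
...   | s≤s z≤n , s≤s (s≤s (s≤s (s≤s z≤n))) = n₁ , n₂ , n₃ , suc n₄ , prep 4 ds↭

module LogConvex (f : ℕ → ℕ) (f>0 : ∀ d → 0 < f d)
                 (convex₂ : f 2 * f 2 < f 1 * f 3) (convex₃ : f 3 * f 3 < f 2 * f 4) where

  weight : List ℕ → ℕ
  weight xs = product (map f xs)

  weight>0 : ∀ xs → 0 < weight xs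
  weight>0 []       = s≤s z≤n
  weight>0 (x ∷ xs) = *-mono-< (f>0 x) (weight>0 xs)

  weight-↭ : ∀ {xs ys} → xs ↭ ys → weight xs ≡ weight ys
  weight-↭ xs↭ys = product-↭ (map⁺ f xs↭ys)

  convex₂₃ : f 2 * f 3 < f 1 * f 4
  convex₂₃ = *-cancelʳ-< (f 2 * f 3) _ _ (begin-strict
    f 2 * f 3 * (f 2 * f 3)    ≡⟨ interchange (f 2) (f 3) (f 2) (f 3) ⟩
    f 2 * f 2 * (f 3 * f 3)    <⟨ *-mono-< convex₂ convex₃ ⟩
    f 1 * f 3 * (f 2 * f 4)    ≡⟨ swap-middle (f 1) (f 2) (f 3) (f 4) ⟩
    f 1 * f 4 * (f 2 * f 3)    ∎)
    where
    open ≤-Reasoning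
    swap-middle : ∀ a b c d → a * c * (b * d) ≡ a * d * (b * c)
    swap-middle = solve-∀

  infix 4 _≼_
  _≼_ : List ℕ → List ℕ → Set
  xs ≼ ys = weight xs ≤ weight ys × (weight xs ≡ weight ys → xs ↭ ys)

  ↭⇒≼ : ∀ {xs ys} → xs ↭ ys → xs ≼ ys
  ↭⇒≼ xs↭ys = ≤-reflexive (weight-↭ xs↭ys) , λ _ → xs↭ys

  ↭-≼-trans : ∀ {xs ys zs} → xs ↭ ys → ys ≼ zs → xs ≼ zs
  ↭-≼-trans xs↭ys (ys≤zs , ys≡zs⇒) =
    ≤-trans (≤-reflexive (weight-↭ xs↭ys)) ys≤zs ,
    λ xs≡zs → ↭-trans xs↭ys (ys≡zs⇒ (trans (sym (weight-↭ xs↭ys)) xs≡zs))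

  <-≼-trans : ∀ {xs ys zs} → weight xs < weight ys → ys ≼ zs → xs ≼ zs
  <-≼-trans xs<ys (ys≤zs , _) = <⇒≤ xs<zs , λ xs≡zs → ⊥-elim (<-irrefl xs≡zs xs<zs)
    where xs<zs = <-≤-trans xs<ys ys≤zs

  exchange : ∀ {x y u v} zs → f x * f y < f u * f v → weight (x ∷ y ∷ zs) < weight (u ∷ v ∷ zs)
  exchange {x} {y} {u} {v} zs lt = begin-strict
    f x * (f y * weight zs)  ≡⟨ *-assoc (f x) (f y) _ ⟨
    f x * f y * weight zs    <⟨ *-monoˡ-< (weight zs) {{>-nonZero (weight>0 zs)}} lt ⟩
    f u * f v * weight zs    ≡⟨ *-assoc (f u) (f v) _ ⟩
    f u * (f v * weight zs)  ∎
    where open ≤-Reasoning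

  module _ {a i r : ℕ} (i<3 : i < 3) where

    improve : ∀ {x y u v zs xs ys} → x ∷ y ∷ zs ↭ xs → u ∷ v ∷ zs ↭ ys
            → x + y ≡ u + v → f x * f y < f u * f v
            → (SameLengthAndSum ys (star a (suc i) r) → ys ≼ star a (suc i) r)
            → SameLengthAndSum xs (star a (suc i) r) → xs ≼ star a (suc i) r
    improve {x} {y} {u} {v} {zs} to-xs to-ys x+y≡u+v lt ys≼ (len , sm) =
      ↭-≼-trans (↭-sym to-xs) (<-≼-trans (exchange zs lt) (↭-≼-trans to-ys (ys≼ (len′ , sm′))))
      where
      len′ = trans (sym (↭-length to-ys)) (trans (↭-length to-xs) len)
      sm′  = trans (sym (sum-↭ to-ys)) (trans (begin
        u + (v + sum zs)  ≡⟨ +-assoc u v _ ⟨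
        u + v + sum zs    ≡⟨ cong (_+ sum zs) x+y≡u+v ⟨
        x + y + sum zs    ≡⟨ +-assoc x y _ ⟩
        x + (y + sum zs)  ∎) (trans (sum-↭ to-xs) sm))
        where open ≡-Reasoning

    star≼star : ∀ {p j q} → j < 3 → SameLengthAndSum (star p (suc j) q) (star a (suc i) r)
              → star p (suc j) q ≼ star a (suc i) r
    star≼star j<3 same = ↭⇒≼ (↭-reflexive (star-injective j<3 i<3 same))

    fromCounts≼star : ∀ n₁ n₂ n₃ n₄ → Acc _<_ (n₂ + n₃)
                    → SameLengthAndSum (fromCounts n₁ n₂ n₃ n₄) (star a (suc i) r)
                    → fromCounts n₁ n₂ n₃ n₄ ≼ star a (suc i) r
    fromCounts≼star zero     0 0 n₄ _ same = ⊥-elim (¬sameLengthAndSum-fours-star i<3 same)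
    fromCounts≼star (suc n₁) 0 0 n₄ _ same = star≼star (s≤s z≤n) same
    fromCounts≼star n₁       1 0 n₄ _ same = star≼star (s≤s (s≤s z≤n)) same
    fromCounts≼star n₁       0 1 n₄ _ same = star≼star (s≤s (s≤s (s≤s z≤n))) same
    fromCounts≼star n₁       1 1 n₄ _ =
      improve (↭-trans (prep 2 (3∷fromCounts n₁ 0 0 n₄)) (2∷fromCounts n₁ 0 1 n₄))
              (1∷fromCounts n₁ 0 0 (suc n₄))
              refl convex₂₃ (star≼star {suc n₄} {q = n₁} (s≤s z≤n))
    fromCounts≼star n₁ (suc (suc n₂)) n₃ n₄ (acc smaller) =
      improve (↭-trans (prep 2 (2∷fromCounts n₁ n₂ n₃ n₄)) (2∷fromCounts n₁ (suc n₂) n₃ n₄))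
              (↭-trans (prep 1 (3∷fromCounts n₁ n₂ n₃ n₄)) (1∷fromCounts n₁ n₂ (suc n₃) n₄))
              refl convex₂
              (fromCounts≼star (suc n₁) n₂ (suc n₃) n₄
                 (smaller (≤-reflexive (cong suc (+-suc n₂ n₃)))))
    fromCounts≼star n₁ n₂ (suc (suc n₃)) n₄ (acc smaller) =
      improve (↭-trans (prep 3 (3∷fromCounts n₁ n₂ n₃ n₄)) (3∷fromCounts n₁ n₂ (suc n₃) n₄))
              (2∷fromCounts n₁ n₂ n₃ (suc n₄))
              refl convex₃
              (fromCounts≼star n₁ (suc n₂) n₃ (suc n₄)
                 (smaller (≤-reflexive (sym (trans (+-suc n₂ (suc n₃)) (cong suc (+-suc n₂ n₃)))))))

    star-maximal : ∀ {ds} → All InRange ds → SameLengthAndSum ds (star a (suc i) r) → ds ≼ star a (suc i) r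
    star-maximal ds∈ same with counts ds∈
    ... | n₁ , n₂ , n₃ , n₄ , ds↭ =
      ↭-≼-trans ds↭ (fromCounts≼star n₁ n₂ n₃ n₄ (<-wellFounded _) (↭-sameLengthAndSum ds↭ same))

-- Scaled self-powers

selfPow : ℕ → ℕ
selfPow x = x ^ x

selfPow>0 : ∀ x → 0 < selfPow x
selfPow>0 zero    = s≤s z≤n
selfPow>0 (suc x) = m^n>0 (suc x) (suc x)

module ScaledSelfPow (c : ℕ) .{{_ : NonZero c}} where

  selfPow-scaled : ∀ d → selfPow (c * d) ≡ ((c * d) ^ d) ^ c
  selfPow-scaled d = trans (cong ((c * d) ^_) (*-comm c d)) (sym (^-*-assoc (c * d) d c))

  scaled-< : ∀ {x y u v} → (c * x) ^ x * (c * y) ^ y < (c * u) ^ u * (c * v) ^ v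
           → selfPow (c * x) * selfPow (c * y) < selfPow (c * u) * selfPow (c * v)
  scaled-< {x} {y} {u} {v} lt = begin-strict
    selfPow (c * x) * selfPow (c * y)      ≡⟨ cong₂ _*_ (selfPow-scaled x) (selfPow-scaled y) ⟩
    ((c * x) ^ x) ^ c * ((c * y) ^ y) ^ c  ≡⟨ ^-distribʳ-* _ _ c ⟨
    ((c * x) ^ x * (c * y) ^ y) ^ c        <⟨ ^-monoˡ-< c lt ⟩
    ((c * u) ^ u * (c * v) ^ v) ^ c        ≡⟨ ^-distribʳ-* _ _ c ⟩
    ((c * u) ^ u) ^ c * ((c * v) ^ v) ^ c  ≡⟨ cong₂ _*_ (selfPow-scaled u) (selfPow-scaled v) ⟨
    selfPow (c * u) * selfPow (c * v)      ∎
    where open ≤-Reasoning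

  -- The ring solver does not normalise `_^_`, so the identities below state the powers unfolded.
  convex₂ : selfPow (c * 2) * selfPow (c * 2) < selfPow (c * 1) * selfPow (c * 3)
  convex₂ = scaled-< (begin-strict
    (c * 2) ^ 2 * (c * 2) ^ 2  ≡⟨ lhs c ⟩
    16 * c ^ 4                 <⟨ *-monoˡ-< (c ^ 4) {{m^n≢0 c 4}} (from-yes (16 <? 27)) ⟩
    27 * c ^ 4                 ≡⟨ rhs c ⟨
    (c * 1) ^ 1 * (c * 3) ^ 3  ∎)
    where
    open ≤-Reasoning
    lhs : ∀ c → (c * 2) * ((c * 2) * 1) * ((c * 2) * ((c * 2) * 1)) ≡ 16 * (c * (c * (c * (c * 1))))
    lhs = solve-∀
    rhs : ∀ c → (c * 1) * 1 * ((c * 3) * ((c * 3) * ((c * 3) * 1))) ≡ 27 * (c * (c * (c * (c * 1))))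
    rhs = solve-∀

  convex₃ : selfPow (c * 3) * selfPow (c * 3) < selfPow (c * 2) * selfPow (c * 4)
  convex₃ = scaled-< (begin-strict
    (c * 3) ^ 3 * (c * 3) ^ 3  ≡⟨ lhs c ⟩
    729 * c ^ 6                <⟨ *-monoˡ-< (c ^ 6) {{m^n≢0 c 6}} (from-yes (729 <? 1024)) ⟩
    1024 * c ^ 6               ≡⟨ rhs c ⟨
    (c * 2) ^ 2 * (c * 4) ^ 4  ∎)
    where
    open ≤-Reasoning
    lhs : ∀ c → (c * 3) * ((c * 3) * ((c * 3) * 1)) * ((c * 3) * ((c * 3) * ((c * 3) * 1)))
              ≡ 729 * (c * (c * (c * (c * (c * (c * 1))))))
    lhs = solve-∀
    rhs : ∀ c → (c * 2) * ((c * 2) * 1) * ((c * 4) * ((c * 4) * ((c * 4) * ((c * 4) * 1))))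
              ≡ 1024 * (c * (c * (c * (c * (c * (c * 1))))))
    rhs = solve-∀

-- Uniform hypergraphs

edgeSize : ∀ {n} (H : Hypergraph n) → Fin (nedges H) → ℕ
edgeSize H e = ∑ λ v → b2n (v ∈ᵇ edge H e)

Uniform : ∀ {n} → ℕ → Hypergraph n → Set
Uniform k H = ∀ e → edgeSize H e ≡ k

expH-↭ : ∀ {n} (H : Hypergraph n) {ds} → lapDegSeq H ↭ ds → expH H ≡ product (map selfPow ds)
expH-↭ H {ds} lapDegSeq↭ds = begin
  expH H                                        ≡⟨ ∏-tabulate (selfPow ∘ lapDeg H) ⟩
  product (List.tabulate (selfPow ∘ lapDeg H))  ≡⟨ cong product (map-tabulate (lapDeg H) selfPow) ⟨
  product (map selfPow (lapDegSeq H))           ≡⟨ product-↭ (map⁺ selfPow lapDegSeq↭ds) ⟩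
  product (map selfPow ds)                      ∎
  where open ≡-Reasoning

degSeq : ∀ {n} → Hypergraph n → List ℕ
degSeq H = List.tabulate (degree H)

module _ {n k} (H : Hypergraph n) (uniform : Uniform k H) where

  degree-sum : ∑ (degree H) ≡ nedges H * k
  degree-sum = begin
    ∑ (degree H)           ≡⟨ ∑-comm (λ v e → b2n (v ∈ᵇ edge H e)) ⟩
    ∑ (edgeSize H)         ≡⟨ ∑-cong uniform ⟩
    ∑ {nedges H} (λ _ → k) ≡⟨ ∑-const (nedges H) k ⟩
    nedges H * k           ∎
    where open ≡-Reasoning

  lapDeg-uniform : ∀ v → lapDeg H v ≡ (k ∸ 1) * degree H v
  lapDeg-uniform v = begin
    lapDeg H v                             ≡⟨ ∑-cong adjCount-via-edges ⟩
    ∑ (λ j → ∑ (λ e → ∋v e * others e j))  ≡⟨ ∑-comm (λ j e → ∋v e * others e j) ⟩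
    ∑ (λ e → ∑ (λ j → ∋v e * others e j))  ≡⟨ ∑-cong (λ e → *-distribˡ-∑ (∋v e) (others e)) ⟨
    ∑ (λ e → ∋v e * ∑ (others e))          ≡⟨ ∑-cong per-edge ⟩
    ∑ (λ e → (k ∸ 1) * ∋v e)               ≡⟨ *-distribˡ-∑ (k ∸ 1) ∋v ⟨
    (k ∸ 1) * degree H v                   ∎
    where
    open ≡-Reasoning
    ∋v : Fin (nedges H) → ℕ
    ∋v e = b2n (v ∈ᵇ edge H e)
    others : Fin (nedges H) → Fin n → ℕ
    others e j = if ⌊ v ≟ j ⌋ then 0 else b2n (j ∈ᵇ edge H e)
    adjCount-via-edges : ∀ j → adjCount H v j ≡ ∑ (λ e → ∋v e * (if ⌊ v ≟ j ⌋ then 0 else b2n (j ∈ᵇ edge H e)))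
    adjCount-via-edges j with ⌊ v ≟ j ⌋
    ... | true  = sym (trans (∑-cong (λ e → *-zeroʳ (∋v e))) (trans (∑-const (nedges H) 0) (*-zeroʳ (nedges H))))
    ... | false = ∑-cong (λ e → b2n-∧ (v ∈ᵇ edge H e) (j ∈ᵇ edge H e))
    others-sum : ∀ e → ∑ (others e) ≡ k ∸ ∋v e
    others-sum e = begin
      ∑ (others e)                ≡⟨ m+n∸m≡n (∋v e) _ ⟨
      ∋v e + ∑ (others e) ∸ ∋v e  ≡⟨ cong (_∸ ∋v e) (trans (∑-punctured (λ j → b2n (j ∈ᵇ edge H e)) v) (uniform e)) ⟩
      k ∸ ∋v e                    ∎
    per-edge : ∀ e → ∋v e * ∑ (others e) ≡ (k ∸ 1) * ∋v e
    per-edge e = begin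
      ∋v e * ∑ (others e)  ≡⟨ cong (∋v e *_) (others-sum e) ⟩
      ∋v e * (k ∸ ∋v e)    ≡⟨ b2n-*-∸ (v ∈ᵇ edge H e) k ⟩
      ∋v e * (k ∸ 1)       ≡⟨ *-comm (∋v e) (k ∸ 1) ⟩
      (k ∸ 1) * ∋v e       ∎

  lapDegSeq-uniform : lapDegSeq H ≡ map ((k ∸ 1) *_) (degSeq H)
  lapDegSeq-uniform = trans (tabulate-cong lapDeg-uniform) (sym (map-tabulate (degree H) ((k ∸ 1) *_)))

  expH-uniform : expH H ≡ product (map (λ d → selfPow ((k ∸ 1) * d)) (degSeq H))
  expH-uniform = trans (expH-↭ H (↭-reflexive lapDegSeq-uniform)) (cong product (sym (map-∘ (degSeq H))))

starSeq-scaled : ∀ k n a i → starSeq k n a i ≡ map ((k ∸ 1) *_) (star a (suc i) (n ∸ a ∸ 1))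
starSeq-scaled k n a i = begin
  replicate a (4 * k ∸ 4) ++ suc i * (k ∸ 1) ∷ replicate q (k ∸ 1)
    ≡⟨ cong₂ (λ x y → replicate a x ++ y ∷ replicate q (k ∸ 1)) four-edges (*-comm (suc i) (k ∸ 1)) ⟩
  replicate a ((k ∸ 1) * 4) ++ (k ∸ 1) * suc i ∷ replicate q (k ∸ 1)
    ≡⟨ cong (λ x → replicate a ((k ∸ 1) * 4) ++ (k ∸ 1) * suc i ∷ replicate q x) (*-identityʳ (k ∸ 1)) ⟨
  replicate a ((k ∸ 1) * 4) ++ (k ∸ 1) * suc i ∷ replicate q ((k ∸ 1) * 1)
    ≡⟨ cong₂ (λ xs ys → xs ++ (k ∸ 1) * suc i ∷ ys) (map-replicate ((k ∸ 1) *_) a 4) (map-replicate ((k ∸ 1) *_) q 1) ⟨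
  map ((k ∸ 1) *_) (replicate a 4) ++ (k ∸ 1) * suc i ∷ map ((k ∸ 1) *_) (replicate q 1)
    ≡⟨ map-++ ((k ∸ 1) *_) (replicate a 4) (suc i ∷ replicate q 1) ⟨
  map ((k ∸ 1) *_) (star a (suc i) q)
    ∎
  where
  open ≡-Reasoning
  q = n ∸ a ∸ 1
  four-edges : 4 * k ∸ 4 ≡ (k ∸ 1) * 4
  four-edges = sym (trans (*-distribʳ-∸ 4 k 1) (cong (_∸ 4) (*-comm k 4)))

expH-starSeq : ∀ {n′} (H : Hypergraph n′) {k n a i} → lapDegSeq H ↭ starSeq k n a i
             → expH H ≡ product (map (λ d → selfPow ((k ∸ 1) * d)) (star a (suc i) (n ∸ a ∸ 1)))
expH-starSeq H {k} {n} {a} {i} lapDegSeq↭starSeq = begin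
  expH H                                                          ≡⟨ expH-↭ H lapDegSeq↭starSeq ⟩
  product (map selfPow (starSeq k n a i))                         ≡⟨ cong (product ∘ map selfPow) (starSeq-scaled k n a i) ⟩
  product (map selfPow (map ((k ∸ 1) *_) (star a (suc i) q)))     ≡⟨ cong product (map-∘ (star a (suc i) q)) ⟨
  product (map (λ d → selfPow ((k ∸ 1) * d)) (star a (suc i) q))  ∎
  where
  open ≡-Reasoning
  q = n ∸ a ∸ 1

-- Powers of trees

Incident : ∀ {p m} → Graph p m → Fin p → Fin m → Set
Incident G u e = u ≡ proj₁ (ends G e) ⊎ u ≡ proj₂ (ends G e)

walk-start-edge : ∀ {p m} {G : Graph p m} {u v} → ¬ u ≡ v → Reach G u v → ∃[ e ] Incident G u e
walk-start-edge u≢v here                          = ⊥-elim (u≢v refl)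
walk-start-edge _   (step (e , inj₁ u,w≡ends) _) = e , inj₁ (cong proj₁ (sym u,w≡ends))
walk-start-edge _   (step (e , inj₂ w,u≡ends) _) = e , inj₂ (cong proj₂ (sym w,u≡ends))

incident-edge : ∀ {p m} {G : Graph (suc (suc p)) m} → Connected G → ∀ u → ∃[ e ] Incident G u e
incident-edge connected zero    = walk-start-edge (λ ()) (connected zero (suc zero))
incident-edge connected (suc u) = walk-start-edge (λ ()) (connected (suc u) zero)

-- The membership test of `power` is local to its definition in Defs and cannot be named here;
-- `memPower` restates it, and `∈-power` recovers the agreement by unification.
memPower : ∀ k {m} → Tree m → Fin m → Fin (suc m) ⊎ Fin (m * (k ∸ 2)) → Bool
memPower k     T e (inj₁ u) = ⌊ u ≟ proj₁ (ends (graph T) e) ⌋ ∨ ⌊ u ≟ proj₂ (ends (graph T) e) ⌋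
memPower k {m} T e (inj₂ w) = ⌊ proj₁ (remQuot {m} (k ∸ 2) w) ≟ e ⌋

lookup-suc-tabulate : ∀ {n} {x : Bool} {g : Fin n → Bool} (xs : Vec Bool (suc n))
                    → xs ≡ x ∷ tabulate g → ∀ v → lookup xs (suc v) ≡ g v
lookup-suc-tabulate _ refl v = lookup∘tabulate _ v

∈-power : ∀ k {m} (T : Tree m) e v → v ∈ᵇ edge (power k T) e ≡ memPower k T e (splitAt (suc m) v)
∈-power k     T e zero    = refl
∈-power k {m} T e (suc v) with splitAt m v | lookup-suc-tabulate (edge (power k T) e) refl v
... | inj₁ _ | member = member
... | inj₂ _ | member = member

∈-power-↑ˡ : ∀ k {m} (T : Tree m) e u → (u ↑ˡ (m * (k ∸ 2))) ∈ᵇ edge (power k T) e ≡ memPower k T e (inj₁ u)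
∈-power-↑ˡ k {m} T e u = trans (∈-power k T e (u ↑ˡ _)) (cong (memPower k T e) (splitAt-↑ˡ (suc m) u (m * (k ∸ 2))))

∈-power-↑ʳ : ∀ k {m} (T : Tree m) e w → (suc m ↑ʳ w) ∈ᵇ edge (power k T) e ≡ memPower k T e (inj₂ w)
∈-power-↑ʳ k {m} T e w = trans (∈-power k T e (suc m ↑ʳ w)) (cong (memPower k T e) (splitAt-↑ʳ (suc m) (m * (k ∸ 2)) w))

b2n-∨-distinct : ∀ {n} (u x y : Fin n) → ¬ x ≡ y → b2n (⌊ u ≟ x ⌋ ∨ ⌊ u ≟ y ⌋) ≡ b2n ⌊ u ≟ x ⌋ + b2n ⌊ u ≟ y ⌋
b2n-∨-distinct u x y x≢y with u ≟ x | u ≟ y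
... | yes refl | yes refl = ⊥-elim (x≢y refl)
... | yes _     | no  _    = refl
... | no  _     | yes _    = refl
... | no  _     | no  _    = refl

power-uniform : ∀ k′ {m} (T : Tree m) → Uniform (2 + k′) (power (2 + k′) T)
power-uniform k′ {m} T e = begin
  edgeSize (power (2 + k′) T) e                          ≡⟨ ∑-↑ (suc m) ∋ ⟩
  ∑ (λ u → ∋ (u ↑ˡ (m * k′))) + ∑ (λ w → ∋ (suc m ↑ʳ w))  ≡⟨ cong₂ _+_ tree-vertices new-vertices ⟩
  2 + k′                                                 ∎
  where
  open ≡-Reasoning
  ∋ : Fin (powVerts (2 + k′) m) → ℕ
  ∋ v = b2n (v ∈ᵇ edge (power (2 + k′) T) e)
  x = proj₁ (ends (graph T) e)
  y = proj₂ (ends (graph T) e)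
  tree-vertices : ∑ (λ u → ∋ (u ↑ˡ (m * k′))) ≡ 2
  tree-vertices = begin
    ∑ (λ u → ∋ (u ↑ˡ (m * k′)))
      ≡⟨ ∑-cong (λ u → cong b2n (∈-power-↑ˡ (2 + k′) T e u)) ⟩
    ∑ (λ u → b2n (⌊ u ≟ x ⌋ ∨ ⌊ u ≟ y ⌋))
      ≡⟨ ∑-cong (λ u → b2n-∨-distinct u x y (loopless (graph T) e)) ⟩
    ∑ (λ u → b2n ⌊ u ≟ x ⌋ + b2n ⌊ u ≟ y ⌋)
      ≡⟨ ∑-distrib-+ (λ u → b2n ⌊ u ≟ x ⌋) (λ u → b2n ⌊ u ≟ y ⌋) ⟩
    ∑ (λ u → b2n ⌊ u ≟ x ⌋) + ∑ (λ u → b2n ⌊ u ≟ y ⌋)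
      ≡⟨ cong₂ _+_ (∑-indicator x) (∑-indicator y) ⟩
    2 ∎
  new-vertices : ∑ (λ w → ∋ (suc m ↑ʳ w)) ≡ k′
  new-vertices = begin
    ∑ (λ w → ∋ (suc m ↑ʳ w))
      ≡⟨ ∑-cong (λ w → cong b2n (∈-power-↑ʳ (2 + k′) T e w)) ⟩
    ∑ (λ w → b2n ⌊ proj₁ (remQuot {m} k′ w) ≟ e ⌋)
      ≡⟨ ∑-combine m k′ (λ w → b2n ⌊ proj₁ (remQuot {m} k′ w) ≟ e ⌋) ⟩
    ∑ {m} (λ i → ∑ {k′} (λ j → b2n ⌊ proj₁ (remQuot {m} k′ (combine i j)) ≟ e ⌋))
      ≡⟨ ∑-cong (λ i → ∑-cong (λ j → cong (λ q → b2n ⌊ proj₁ q ≟ e ⌋) (remQuot-combine {k = k′} i j))) ⟩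
    ∑ {m} (λ i → ∑ {k′} (λ _ → b2n ⌊ i ≟ e ⌋))
      ≡⟨ ∑-cong (λ i → ∑-const k′ (b2n ⌊ i ≟ e ⌋)) ⟩
    ∑ (λ i → k′ * b2n ⌊ i ≟ e ⌋)
      ≡⟨ *-distribˡ-∑ k′ (λ i → b2n ⌊ i ≟ e ⌋) ⟨
    k′ * ∑ (λ i → b2n ⌊ i ≟ e ⌋)
      ≡⟨ cong (k′ *_) (∑-indicator e) ⟩
    k′ * 1
      ≡⟨ *-identityʳ k′ ⟩
    k′ ∎

covering-edge : ∀ k {m} (T : Tree (suc m)) s → ∃[ e ] memPower k T e s ≡ true
covering-edge k {m} T (inj₂ w) = proj₁ (remQuot {suc m} (k ∸ 2) w) , ⌊⌋-true (_ ≟ _) refl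
covering-edge k     T (inj₁ u) with incident-edge (connected T) u
... | e , inj₁ u≡x = e , cong (_∨ ⌊ u ≟ proj₂ (ends (graph T) e) ⌋) (⌊⌋-true (u ≟ _) u≡x)
... | e , inj₂ u≡y = e , trans (cong (⌊ u ≟ proj₁ (ends (graph T) e) ⌋ ∨_) (⌊⌋-true (u ≟ _) u≡y)) (∨-zeroʳ _)

degree-power-pos : ∀ k {m} (T : Tree (suc m)) v → 1 ≤ degree (power k T) v
degree-power-pos k {m} T v with covering-edge k T (splitAt (suc (suc m)) v)
... | e , member = subst (_≤ degree (power k T) v) (cong b2n (trans (∈-power k T e v) member))
                         (term≤∑ (λ e → b2n (v ∈ᵇ edge (power k T) e)) e)

sum-degSeq-power : ∀ k′ {e} (T : Tree (suc e)) → sum (degSeq (power (2 + k′) T)) ≡ length (degSeq (power (2 + k′) T)) + e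
sum-degSeq-power k′ {e} T = begin
  sum (degSeq H)                 ≡⟨ ∑-tabulate (degree H) ⟨
  ∑ (degree H)                   ≡⟨ degree-sum H (power-uniform k′ T) ⟩
  suc e * (2 + k′)               ≡⟨ arith e k′ ⟩
  powVerts (2 + k′) (suc e) + e  ≡⟨ cong (_+ e) (length-tabulate (degree H)) ⟨
  length (degSeq H) + e          ∎
  where
  open ≡-Reasoning
  H = power (2 + k′) T
  arith : ∀ e k′ → suc e * (2 + k′) ≡ suc (suc e) + suc e * k′ + e
  arith = solve-∀

degSeq-power-star : ∀ k′ a i (T : Tree (suc (3 * a + i)))
                  → SameLengthAndSum (degSeq (power (2 + k′) T)) (star a (suc i) (powVerts (2 + k′) (suc (3 * a + i)) ∸ a ∸ 1))
degSeq-power-star k′ a i T = sameLengthAndSum-star (begin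
    length (degSeq H)                    ≡⟨ length-tabulate (degree H) ⟩
    N                                    ≡⟨ N≡ ⟩
    a + suc r                            ≡⟨ cong (λ q → a + suc q) r≡ ⟨
    a + suc (N ∸ a ∸ 1)                  ≡⟨ length-star a (suc i) (N ∸ a ∸ 1) ⟨
    length (star a (suc i) (N ∸ a ∸ 1))  ∎)
  (trans (sum-degSeq-power k′ T) (cong (length (degSeq H) +_) (trans (+-comm (3 * a) i) (cong (i +_) (*-comm 3 a)))))
  where
  open ≡-Reasoning
  H = power (2 + k′) T
  N = powVerts (2 + k′) (suc (3 * a + i))
  r = suc (2 * a + i) + suc (3 * a + i) * k′
  N≡ : N ≡ a + suc r
  N≡ = arith a i k′
    where
    arith : ∀ a i k′ → suc (suc (3 * a + i)) + suc (3 * a + i) * k′ ≡ a + suc (suc (2 * a + i) + suc (3 * a + i) * k′)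
    arith = solve-∀
  r≡ : N ∸ a ∸ 1 ≡ r
  r≡ = trans (cong (λ n → n ∸ a ∸ 1) N≡) (cong (_∸ 1) (m+n∸m≡n a (suc r)))

lemma3p5 : (k : ℕ) → 3 ≤ k → (m : ℕ) → (T : Tree m)
    → Chemical (power k T)
    → (a i : ℕ) → i < 3 → m ≡ suc (3 * a + i)
    → (T* : Tree m)
    → lapDegSeq (power k T*) ↭ starSeq k (powVerts k m) a i
    → (expH (power k T) ≤ expH (power k T*))
      × ((expH (power k T) ≡ expH (power k T*))
          ⇔ (lapDegSeq (power k T) ↭ starSeq k (powVerts k m) a i))
lemma3p5 (suc (suc k′)) (s≤s (s≤s _)) .(suc (3 * a + i)) T chemical a i i<3 refl T* T*-star =
  subst₂ _≤_ (sym expH-T) (sym expH-T*) (proj₁ T≼T*) ,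
  mk⇔ (λ expH≡ → subst₂ _↭_ (sym (lapDegSeq-uniform H (power-uniform k′ T))) (sym (starSeq-scaled (2 + k′) _ a i))
                   (map⁺ (suc k′ *_) (proj₂ T≼T* (trans (sym expH-T) (trans expH≡ expH-T*)))))
      (λ T-star → trans (expH-↭ H T-star) (sym (expH-↭ H* T*-star)))
  where
  H  = power (2 + k′) T
  H* = power (2 + k′) T*
  S  = star a (suc i) (powVerts (2 + k′) (suc (3 * a + i)) ∸ a ∸ 1)
  open LogConvex (λ d → selfPow (suc k′ * d)) (λ d → selfPow>0 (suc k′ * d))
                 (ScaledSelfPow.convex₂ (suc k′)) (ScaledSelfPow.convex₃ (suc k′))

  expH-T : expH H ≡ weight (degSeq H)
  expH-T = expH-uniform H (power-uniform k′ T)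

  expH-T* : expH H* ≡ weight S
  expH-T* = expH-starSeq H* {k = 2 + k′} T*-star

  T≼T* : degSeq H ≼ S
  T≼T* = star-maximal i<3 (tabulate⁺ (λ v → degree-power-pos (2 + k′) T v , chemical v)) (degSeq-power-star k′ a i T)
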